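{- For any strictly positive first-order formula $\varphi(X,x)$ and any formula $\theta(x)$, \[\mathrm{CM}\vdash\forall x\,\bigl(\varphi(\theta,x)\rightarrow\exists X\,(\forall z\,(z\in_1X\rightarrow\theta(z))\land\varphi(X,x))\bigr).\]
   Context: A formula $\varphi(X,x)$ (possibly with further free number variables) is strictly positive first-order if built from atomic formulas of $\mathrm{PA}$, atomic formulas $t\in_1X$, and $\bot$, using $\land$, $\lor$, $\rightarrow$ (with $X$ not occurring in any antecedent of $\rightarrow$) and first-order quantifiers $\forall y,\exists y$. $\varphi(\theta,x)$ denotes the result of replacing each occurrence of $t\in_1X$ by $\theta(t)$ (avoiding variable capture). $\mathrm{CM}$ is the intuitionistic three-sorted theory (numbers; sets of numbers $X,Y,\dots$; sets of sets $\mathbf{X},\dots$; symbols $0$, successor, $+$, $\cdot$, number equality, $\in_1$, $\in_2$, binary relation $\prec$ on sets) with axioms: $\mathrm{PA}$ without induction; induction for all formulas; dependent choice $\forall n\,\forall X\,\exists Y\,\varphi(n,X,Y)\rightarrow\forall X\,\exists Z((Z)_0=X\land\forall n\,\varphi(n,(Z)_n,(Z)_{n+1}))$ where $(Z)_n=\{m:\langle n,m\rangle\in_1Z\}$, $\langle m,n\rangle=(m+n)(m+n+1)/2+m$; decidable comprehension at second and third order; decidability of atomic formulas $n=m$, $n\in_1X$, $X\in_2\mathbf{X}$, $X\prec Y$; numerical omniscience $\forall n(\varphi(n)\lor\psi(n))\rightarrow(\forall n\,\varphi(n)\lor\exists n\,\psi(n))$; and extensionality of $\in_2$ and $\prec$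 with respect to $X=Y:\equiv\forall n(n\in_1X\leftrightarrow n\in_1Y)$. -}

module Defs where

-- Variables are de Bruijn indices, separately for each sort:
--   number variables  v k,   set variables  k : ℕ,   set-of-sets variables  k : ℕ.

open import Function using (_∘_)
open import Data.Nat using (ℕ; zero; suc)
open import Data.List using (List; _∷_; []; map)
open import Data.List.Membership.Propositional using (_∈_)

infixl 7 _⊗_
infixl 6 _⊕_
infix  4 _≐_ _∈¹_ _∈²_ _≺_
infixr 3 _∧̇_
infixr 2 _∨̇_
infixr 1 _⇒_ _⇔_
infix  0 _⊢_

data Tm : Set where
  v       : ℕ → Tm
  𝟎       : Tm
  S       : Tm → Tm
  _⊕_ _⊗_ : Tm → Tm → Tm

data Fm : Set where
  _≐_   : Tm → Tm → Fm
  _∈¹_  : Tm → ℕ → Fm       -- t ∈₁ X   (X a set variable)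
  _∈²_  : ℕ → ℕ → Fm        -- X ∈₂ 𝐗   (𝐗 a set-of-sets variable)
  _≺_   : ℕ → ℕ → Fm
  ⊥̇     : Fm
  _∧̇_ _∨̇_ _⇒_ : Fm → Fm → Fm
  ∀⁰ ∃⁰ : Fm → Fm
  ∀¹ ∃¹ : Fm → Fm
  ∀² ∃² : Fm → Fm

¬̇_ : Fm → Fm
¬̇ A = A ⇒ ⊥̇

_⇔_ : Fm → Fm → Fm
A ⇔ B = (A ⇒ B) ∧̇ (B ⇒ A)

substTm : (ℕ → Tm) → Tm → Tm
substTm σ (v k)   = σ k
substTm σ 𝟎       = 𝟎
substTm σ (S t)   = S (substTm σ t)
substTm σ (s ⊕ t) = substTm σ s ⊕ substTm σ t
substTm σ (s ⊗ t) = substTm σ s ⊗ substTm σ t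

shiftTm : Tm → Tm
shiftTm = substTm (v ∘ suc)

liftσ : (ℕ → Tm) → ℕ → Tm
liftσ σ zero    = v zero
liftσ σ (suc k) = shiftTm (σ k)

liftρ : (ℕ → ℕ) → ℕ → ℕ
liftρ ρ zero    = zero
liftρ ρ (suc k) = suc (ρ k)

substN : (ℕ → Tm) → Fm → Fm
substN σ (s ≐ t)  = substTm σ s ≐ substTm σ t
substN σ (t ∈¹ i) = substTm σ t ∈¹ i
substN σ (i ∈² c) = i ∈² c
substN σ (i ≺ j)  = i ≺ j
substN σ ⊥̇        = ⊥̇
substN σ (A ∧̇ B)  = substN σ A ∧̇ substN σ B
substN σ (A ∨̇ B)  = substN σ A ∨̇ substN σ B
substN σ (A ⇒ B)  = substN σ A ⇒ substN σ B
substN σ (∀⁰ A)   = ∀⁰ (substN (liftσ σ) A)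
substN σ (∃⁰ A)   = ∃⁰ (substN (liftσ σ) A)
substN σ (∀¹ A)   = ∀¹ (substN σ A)
substN σ (∃¹ A)   = ∃¹ (substN σ A)
substN σ (∀² A)   = ∀² (substN σ A)
substN σ (∃² A)   = ∃² (substN σ A)

renS : (ℕ → ℕ) → Fm → Fm
renS ρ (s ≐ t)  = s ≐ t
renS ρ (t ∈¹ i) = t ∈¹ ρ i
renS ρ (i ∈² c) = ρ i ∈² c
renS ρ (i ≺ j)  = ρ i ≺ ρ j
renS ρ ⊥̇        = ⊥̇
renS ρ (A ∧̇ B)  = renS ρ A ∧̇ renS ρ B
renS ρ (A ∨̇ B)  = renS ρ A ∨̇ renS ρ B
renS ρ (A ⇒ B)  = renS ρ A ⇒ renS ρ B
renS ρ (∀⁰ A)   = ∀⁰ (renS ρ A)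
renS ρ (∃⁰ A)   = ∃⁰ (renS ρ A)
renS ρ (∀¹ A)   = ∀¹ (renS (liftρ ρ) A)
renS ρ (∃¹ A)   = ∃¹ (renS (liftρ ρ) A)
renS ρ (∀² A)   = ∀² (renS ρ A)
renS ρ (∃² A)   = ∃² (renS ρ A)

renC : (ℕ → ℕ) → Fm → Fm
renC ρ (s ≐ t)  = s ≐ t
renC ρ (t ∈¹ i) = t ∈¹ i
renC ρ (i ∈² c) = i ∈² ρ c
renC ρ (i ≺ j)  = i ≺ j
renC ρ ⊥̇        = ⊥̇
renC ρ (A ∧̇ B)  = renC ρ A ∧̇ renC ρ B
renC ρ (A ∨̇ B)  = renC ρ A ∨̇ renC ρ B
renC ρ (A ⇒ B)  = renC ρ A ⇒ renC ρ B
renC ρ (∀⁰ A)   = ∀⁰ (renC ρ A)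
renC ρ (∃⁰ A)   = ∃⁰ (renC ρ A)
renC ρ (∀¹ A)   = ∀¹ (renC ρ A)
renC ρ (∃¹ A)   = ∃¹ (renC ρ A)
renC ρ (∀² A)   = ∀² (renC (liftρ ρ) A)
renC ρ (∃² A)   = ∃² (renC (liftρ ρ) A)

shiftN shiftS shiftC : Fm → Fm
shiftN = substN (v ∘ suc)
shiftS = renS suc
shiftC = renC suc

inst : Tm → ℕ → Tm
inst t zero    = t
inst t (suc k) = v k

_[_] : Fm → Tm → Fm
A [ t ] = substN (inst t) A

instV : ℕ → ℕ → ℕ
instV j zero    = j
instV j (suc k) = k

_≡ˢ_ : ℕ → ℕ → Fm
i ≡ˢ j = ∀⁰ (v 0 ∈¹ i ⇔ v 0 ∈¹ j)

-- ⟨a,b⟩ ∈₁ Z, with ⟨a,b⟩ = (a+b)(a+b+1)/2 + a, i.e. the p with 2p = (a+b)(a+b+1) + 2a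
pairIn : Tm → Tm → ℕ → Fm
pairIn a b Z = ∃⁰ ((v 0 ⊕ v 0 ≐ (a' ⊕ b') ⊗ S (a' ⊕ b') ⊕ (a' ⊕ a')) ∧̇ v 0 ∈¹ Z)
  where
  a' = shiftTm a
  b' = shiftTm b

-- Dependent choice instance for φ(n,X,Y):
-- φ has number variable 0 = n, set variable 1 = X, set variable 0 = Y,
-- number variables k+1 and set variables j+2 are parameters.
-- (Z)_n = X' is rendered as ∀m (m ∈₁ X' ↔ ⟨n,m⟩ ∈₁ Z), and φ(n,(Z)_n,(Z)_{n+1}) as
-- ∀U ∀V (U = (Z)_n → V = (Z)_{n+1} → φ(n,U,V)).
dcFormula : Fm → Fm
dcFormula φ =
  ∀⁰ (∀¹ (∃¹ φ)) ⇒
  ∀¹ (∃¹ (                                        -- sets: 0 = Z, 1 = X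
      ∀⁰ (pairIn 𝟎 (v 0) 0 ⇔ v 0 ∈¹ 1)             -- (Z)_0 = X
   ∧̇ ∀⁰ (∀¹ (∀¹ (                                  -- number 0 = n; sets 0 = V, 1 = U, 2 = Z
        ∀⁰ (v 0 ∈¹ 1 ⇔ pairIn (v 1) (v 0) 2) ⇒     -- U = (Z)_n
        ∀⁰ (v 0 ∈¹ 0 ⇔ pairIn (S (v 1)) (v 0) 2) ⇒ -- V = (Z)_{n+1}
        renS ρ φ)))))
  where
  ρ : ℕ → ℕ
  ρ zero          = zero
  ρ (suc zero)    = suc zero
  ρ (suc (suc j)) = suc (suc (suc (suc j)))

-- σ with 0 ↦ S(v 0), k+1 ↦ v (k+1)   (A(x) ↦ A(x+1))
stepσ : ℕ → Tm
stepσ zero    = S (v zero)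
stepσ (suc k) = v (suc k)

data CMAx : Fm → Set where
  q-S≢0   : ∀ t   → CMAx (¬̇ (S t ≐ 𝟎))
  q-Sinj  : ∀ s t → CMAx (S s ≐ S t ⇒ s ≐ t)
  q-+0    : ∀ t   → CMAx (t ⊕ 𝟎 ≐ t)
  q-+S    : ∀ s t → CMAx (s ⊕ S t ≐ S (s ⊕ t))
  q-*0    : ∀ t   → CMAx (t ⊗ 𝟎 ≐ 𝟎)
  q-*S    : ∀ s t → CMAx (s ⊗ S t ≐ s ⊗ t ⊕ s)
  -- induction for all formulas (A has the induction variable as number variable 0)
  ind     : ∀ A → CMAx ((A [ 𝟎 ] ∧̇ ∀⁰ (A ⇒ substN stepσ A)) ⇒ ∀⁰ A)
  dc      : ∀ φ → CMAx (dcFormula φ)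
  comp²   : ∀ A → CMAx (∀⁰ (A ∨̇ ¬̇ A) ⇒ ∃¹ (∀⁰ (v 0 ∈¹ 0 ⇔ shiftS A)))
  comp³   : ∀ A → CMAx (∀¹ (A ∨̇ ¬̇ A) ⇒ ∃² (∀¹ (0 ∈² 0 ⇔ shiftC A)))
  dec-≐   : ∀ s t → CMAx (s ≐ t ∨̇ ¬̇ (s ≐ t))
  dec-∈¹  : ∀ t i → CMAx (t ∈¹ i ∨̇ ¬̇ (t ∈¹ i))
  dec-∈²  : ∀ i c → CMAx (i ∈² c ∨̇ ¬̇ (i ∈² c))
  dec-≺   : ∀ i j → CMAx (i ≺ j ∨̇ ¬̇ (i ≺ j))
  omni    : ∀ A B → CMAx (∀⁰ (A ∨̇ B) ⇒ (∀⁰ A ∨̇ ∃⁰ B))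
  ext-∈²  : ∀ i j c → CMAx (i ≡ˢ j ⇒ i ∈² c ⇒ j ∈² c)
  ext-≺ˡ  : ∀ i j k → CMAx (i ≡ˢ j ⇒ i ≺ k ⇒ j ≺ k)
  ext-≺ʳ  : ∀ i j k → CMAx (i ≡ˢ j ⇒ k ≺ i ⇒ k ≺ j)

data _⊢_ (Γ : List Fm) : Fm → Set where
  hyp  : ∀ {A} → A ∈ Γ → Γ ⊢ A
  axm  : ∀ {A} → CMAx A → Γ ⊢ A
  ⊥E   : ∀ {A} → Γ ⊢ ⊥̇ → Γ ⊢ A
  ∧I   : ∀ {A B} → Γ ⊢ A → Γ ⊢ B → Γ ⊢ A ∧̇ B
  ∧E₁  : ∀ {A B} → Γ ⊢ A ∧̇ B → Γ ⊢ A
  ∧E₂  : ∀ {A B} → Γ ⊢ A ∧̇ B → Γ ⊢ B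
  ∨I₁  : ∀ {A B} → Γ ⊢ A → Γ ⊢ A ∨̇ B
  ∨I₂  : ∀ {A B} → Γ ⊢ B → Γ ⊢ A ∨̇ B
  ∨E   : ∀ {A B C} → Γ ⊢ A ∨̇ B → (A ∷ Γ) ⊢ C → (B ∷ Γ) ⊢ C → Γ ⊢ C
  ⇒I   : ∀ {A B} → (A ∷ Γ) ⊢ B → Γ ⊢ A ⇒ B
  ⇒E   : ∀ {A B} → Γ ⊢ A ⇒ B → Γ ⊢ A → Γ ⊢ B
  ∀⁰I  : ∀ {A} → map shiftN Γ ⊢ A → Γ ⊢ ∀⁰ A
  ∀⁰E  : ∀ {A} → Γ ⊢ ∀⁰ A → (t : Tm) → Γ ⊢ A [ t ]
  ∃⁰I  : ∀ {A} (t : Tm) → Γ ⊢ A [ t ] → Γ ⊢ ∃⁰ A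
  ∃⁰E  : ∀ {A B} → Γ ⊢ ∃⁰ A → (A ∷ map shiftN Γ) ⊢ shiftN B → Γ ⊢ B
  ∀¹I  : ∀ {A} → map shiftS Γ ⊢ A → Γ ⊢ ∀¹ A
  ∀¹E  : ∀ {A} → Γ ⊢ ∀¹ A → (j : ℕ) → Γ ⊢ renS (instV j) A
  ∃¹I  : ∀ {A} (j : ℕ) → Γ ⊢ renS (instV j) A → Γ ⊢ ∃¹ A
  ∃¹E  : ∀ {A B} → Γ ⊢ ∃¹ A → (A ∷ map shiftS Γ) ⊢ shiftS B → Γ ⊢ B
  ∀²I  : ∀ {A} → map shiftC Γ ⊢ A → Γ ⊢ ∀² A
  ∀²E  : ∀ {A} → Γ ⊢ ∀² A → (j : ℕ) → Γ ⊢ renC (instV j) A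
  ∃²I  : ∀ {A} (j : ℕ) → Γ ⊢ renC (instV j) A → Γ ⊢ ∃² A
  ∃²E  : ∀ {A B} → Γ ⊢ ∃² A → (A ∷ map shiftC Γ) ⊢ shiftC B → Γ ⊢ B
  ≐refl : ∀ t → Γ ⊢ t ≐ t
  ≐subst : ∀ {s t} A → Γ ⊢ s ≐ t → Γ ⊢ A [ s ] → Γ ⊢ A [ t ]

CM⊢ : Fm → Set
CM⊢ A = [] ⊢ A

-- formulas of PA (used as antecedents of → in which X does not occur)
data AF : Set where
  a-eq  : Tm → Tm → AF
  a-bot : AF
  a-and a-or a-imp : AF → AF → AF
  a-all a-ex : AF → AF

data SPF : Set where
  s-eq  : Tm → Tm → SPF
  s-mem : Tm → SPF
  s-bot : SPF
  s-and s-or : SPF → SPF → SPF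
  s-imp : AF → SPF → SPF
  s-all s-ex : SPF → SPF

embAF : AF → Fm
embAF (a-eq s t)  = s ≐ t
embAF a-bot       = ⊥̇
embAF (a-and A B) = embAF A ∧̇ embAF B
embAF (a-or A B)  = embAF A ∨̇ embAF B
embAF (a-imp A B) = embAF A ⇒ embAF B
embAF (a-all A)   = ∀⁰ (embAF A)
embAF (a-ex A)    = ∃⁰ (embAF A)

-- φ(X, x) with X the set variable 0
embX : SPF → Fm
embX (s-eq s t)  = s ≐ t
embX (s-mem t)   = t ∈¹ 0
embX s-bot       = ⊥̇
embX (s-and A B) = embX A ∧̇ embX B
embX (s-or A B)  = embX A ∨̇ embX B
embX (s-imp A B) = embAF A ⇒ embX B
embX (s-all A)   = ∀⁰ (embX A)
embX (s-ex A)    = ∃⁰ (embX A)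

-- An abstraction θ(z): number variable 0 is z, number variable k+1 is the k-th
-- variable of the surrounding context.  liftAbs moves it under one number binder.
liftAbs : Fm → Fm
liftAbs = substN (liftσ (v ∘ suc))

plug : Fm → SPF → Fm
plug θ (s-eq s t)  = s ≐ t
plug θ (s-mem t)   = θ [ t ]
plug θ s-bot       = ⊥̇
plug θ (s-and A B) = plug θ A ∧̇ plug θ B
plug θ (s-or A B)  = plug θ A ∨̇ plug θ B
plug θ (s-imp A B) = embAF A ⇒ plug θ B
plug θ (s-all A)   = ∀⁰ (plug (liftAbs θ) A)
plug θ (s-ex A)    = ∃⁰ (plug (liftAbs θ) A)

{-# OPTIONS --safe #-}
module Submission where

-- By induction on φ one builds, from a proof of φ(θ), a set X ⊆ {z | θ(z)} with φ(X).
-- An atom t ∈₁ X is witnessed by the singleton {t}, the other atoms by ∅, a conjunction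
-- by the union of the two witnesses, and ∀y φ(y) by the union of a sequence of
-- witnesses, one for each y, chosen at once by dependent choice.  Unions are harmless
-- because strict positivity makes φ(X) monotone in X.  In α → ψ the antecedent α does
-- not mention X and is arithmetical, hence decidable by numerical omniscience: if α holds
-- the witness for ψ works, otherwise ∅ does.

open import Defs
open import Function using (_∘_; id)
open import Data.Nat using (ℕ; zero; suc)
open import Data.List using (List; _∷_; [])
open import Data.List.Relation.Binary.Subset.Propositional using (_⊆_)
open import Data.List.Relation.Binary.Subset.Propositional.Properties using (map⁺; ∷⁺ʳ)
open import Data.List.Relation.Unary.Any using (here; there)
open import Relation.Binary.PropositionalEquality
  using (_≡_; refl; sym; trans; cong; cong₂; subst; _≗_)

substTm-cong : ∀ {σ τ} → σ ≗ τ → substTm σ ≗ substTm τ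
substTm-cong e (v k)   = e k
substTm-cong e 𝟎       = refl
substTm-cong e (S t)   = cong S (substTm-cong e t)
substTm-cong e (s ⊕ t) = cong₂ _⊕_ (substTm-cong e s) (substTm-cong e t)
substTm-cong e (s ⊗ t) = cong₂ _⊗_ (substTm-cong e s) (substTm-cong e t)

substTm-∘ : ∀ σ τ t → substTm σ (substTm τ t) ≡ substTm (substTm σ ∘ τ) t
substTm-∘ σ τ (v k)   = refl
substTm-∘ σ τ 𝟎       = refl
substTm-∘ σ τ (S t)   = cong S (substTm-∘ σ τ t)
substTm-∘ σ τ (s ⊕ t) = cong₂ _⊕_ (substTm-∘ σ τ s) (substTm-∘ σ τ t)
substTm-∘ σ τ (s ⊗ t) = cong₂ _⊗_ (substTm-∘ σ τ s) (substTm-∘ σ τ t)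

substTm-id : substTm v ≗ id
substTm-id (v k)   = refl
substTm-id 𝟎       = refl
substTm-id (S t)   = cong S (substTm-id t)
substTm-id (s ⊕ t) = cong₂ _⊕_ (substTm-id s) (substTm-id t)
substTm-id (s ⊗ t) = cong₂ _⊗_ (substTm-id s) (substTm-id t)

liftσ-cong : ∀ {σ τ} → σ ≗ τ → liftσ σ ≗ liftσ τ
liftσ-cong e zero    = refl
liftσ-cong e (suc k) = cong shiftTm (e k)

liftσ-∘ : ∀ σ τ → substTm (liftσ σ) ∘ liftσ τ ≗ liftσ (substTm σ ∘ τ)
liftσ-∘ σ τ zero    = refl
liftσ-∘ σ τ (suc k) =
  trans (substTm-∘ (liftσ σ) (v ∘ suc) (τ k)) (sym (substTm-∘ (v ∘ suc) σ (τ k)))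

liftσ-id : liftσ v ≗ v
liftσ-id zero    = refl
liftσ-id (suc k) = refl

substN-cong : ∀ {σ τ} → σ ≗ τ → substN σ ≗ substN τ
substN-cong e (s ≐ t)  = cong₂ _≐_ (substTm-cong e s) (substTm-cong e t)
substN-cong e (t ∈¹ i) = cong (_∈¹ i) (substTm-cong e t)
substN-cong e (i ∈² c) = refl
substN-cong e (i ≺ j)  = refl
substN-cong e ⊥̇        = refl
substN-cong e (A ∧̇ B)  = cong₂ _∧̇_ (substN-cong e A) (substN-cong e B)
substN-cong e (A ∨̇ B)  = cong₂ _∨̇_ (substN-cong e A) (substN-cong e B)
substN-cong e (A ⇒ B)  = cong₂ _⇒_ (substN-cong e A) (substN-cong e B)
substN-cong e (∀⁰ A)   = cong ∀⁰ (substN-cong (liftσ-cong e) A)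
substN-cong e (∃⁰ A)   = cong ∃⁰ (substN-cong (liftσ-cong e) A)
substN-cong e (∀¹ A)   = cong ∀¹ (substN-cong e A)
substN-cong e (∃¹ A)   = cong ∃¹ (substN-cong e A)
substN-cong e (∀² A)   = cong ∀² (substN-cong e A)
substN-cong e (∃² A)   = cong ∃² (substN-cong e A)

substN-∘ : ∀ σ τ A → substN σ (substN τ A) ≡ substN (substTm σ ∘ τ) A
substN-∘ σ τ (s ≐ t)  = cong₂ _≐_ (substTm-∘ σ τ s) (substTm-∘ σ τ t)
substN-∘ σ τ (t ∈¹ i) = cong (_∈¹ i) (substTm-∘ σ τ t)
substN-∘ σ τ (i ∈² c) = refl
substN-∘ σ τ (i ≺ j)  = refl
substN-∘ σ τ ⊥̇        = refl
substN-∘ σ τ (A ∧̇ B)  = cong₂ _∧̇_ (substN-∘ σ τ A) (substN-∘ σ τ B)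
substN-∘ σ τ (A ∨̇ B)  = cong₂ _∨̇_ (substN-∘ σ τ A) (substN-∘ σ τ B)
substN-∘ σ τ (A ⇒ B)  = cong₂ _⇒_ (substN-∘ σ τ A) (substN-∘ σ τ B)
substN-∘ σ τ (∀⁰ A)   =
  cong ∀⁰ (trans (substN-∘ (liftσ σ) (liftσ τ) A) (substN-cong (liftσ-∘ σ τ) A))
substN-∘ σ τ (∃⁰ A)   =
  cong ∃⁰ (trans (substN-∘ (liftσ σ) (liftσ τ) A) (substN-cong (liftσ-∘ σ τ) A))
substN-∘ σ τ (∀¹ A)   = cong ∀¹ (substN-∘ σ τ A)
substN-∘ σ τ (∃¹ A)   = cong ∃¹ (substN-∘ σ τ A)
substN-∘ σ τ (∀² A)   = cong ∀² (substN-∘ σ τ A)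
substN-∘ σ τ (∃² A)   = cong ∃² (substN-∘ σ τ A)

substN-id : substN v ≗ id
substN-id (s ≐ t)  = cong₂ _≐_ (substTm-id s) (substTm-id t)
substN-id (t ∈¹ i) = cong (_∈¹ i) (substTm-id t)
substN-id (i ∈² c) = refl
substN-id (i ≺ j)  = refl
substN-id ⊥̇        = refl
substN-id (A ∧̇ B)  = cong₂ _∧̇_ (substN-id A) (substN-id B)
substN-id (A ∨̇ B)  = cong₂ _∨̇_ (substN-id A) (substN-id B)
substN-id (A ⇒ B)  = cong₂ _⇒_ (substN-id A) (substN-id B)
substN-id (∀⁰ A)   = cong ∀⁰ (trans (substN-cong liftσ-id A) (substN-id A))
substN-id (∃⁰ A)   = cong ∃⁰ (trans (substN-cong liftσ-id A) (substN-id A))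
substN-id (∀¹ A)   = cong ∀¹ (substN-id A)
substN-id (∃¹ A)   = cong ∃¹ (substN-id A)
substN-id (∀² A)   = cong ∀² (substN-id A)
substN-id (∃² A)   = cong ∃² (substN-id A)

liftρ-cong : ∀ {ρ τ} → ρ ≗ τ → liftρ ρ ≗ liftρ τ
liftρ-cong e zero    = refl
liftρ-cong e (suc k) = cong suc (e k)

liftρ-∘ : ∀ ρ τ → liftρ ρ ∘ liftρ τ ≗ liftρ (ρ ∘ τ)
liftρ-∘ ρ τ zero    = refl
liftρ-∘ ρ τ (suc k) = refl

liftρ-id : liftρ id ≗ id
liftρ-id zero    = refl
liftρ-id (suc k) = refl

renS-cong : ∀ {ρ τ} → ρ ≗ τ → renS ρ ≗ renS τ
renS-cong e (s ≐ t)  = refl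
renS-cong e (t ∈¹ i) = cong (t ∈¹_) (e i)
renS-cong e (i ∈² c) = cong (_∈² c) (e i)
renS-cong e (i ≺ j)  = cong₂ _≺_ (e i) (e j)
renS-cong e ⊥̇        = refl
renS-cong e (A ∧̇ B)  = cong₂ _∧̇_ (renS-cong e A) (renS-cong e B)
renS-cong e (A ∨̇ B)  = cong₂ _∨̇_ (renS-cong e A) (renS-cong e B)
renS-cong e (A ⇒ B)  = cong₂ _⇒_ (renS-cong e A) (renS-cong e B)
renS-cong e (∀⁰ A)   = cong ∀⁰ (renS-cong e A)
renS-cong e (∃⁰ A)   = cong ∃⁰ (renS-cong e A)
renS-cong e (∀¹ A)   = cong ∀¹ (renS-cong (liftρ-cong e) A)
renS-cong e (∃¹ A)   = cong ∃¹ (renS-cong (liftρ-cong e) A)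
renS-cong e (∀² A)   = cong ∀² (renS-cong e A)
renS-cong e (∃² A)   = cong ∃² (renS-cong e A)

renS-∘ : ∀ ρ τ A → renS ρ (renS τ A) ≡ renS (ρ ∘ τ) A
renS-∘ ρ τ (s ≐ t)  = refl
renS-∘ ρ τ (t ∈¹ i) = refl
renS-∘ ρ τ (i ∈² c) = refl
renS-∘ ρ τ (i ≺ j)  = refl
renS-∘ ρ τ ⊥̇        = refl
renS-∘ ρ τ (A ∧̇ B)  = cong₂ _∧̇_ (renS-∘ ρ τ A) (renS-∘ ρ τ B)
renS-∘ ρ τ (A ∨̇ B)  = cong₂ _∨̇_ (renS-∘ ρ τ A) (renS-∘ ρ τ B)
renS-∘ ρ τ (A ⇒ B)  = cong₂ _⇒_ (renS-∘ ρ τ A) (renS-∘ ρ τ B)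
renS-∘ ρ τ (∀⁰ A)   = cong ∀⁰ (renS-∘ ρ τ A)
renS-∘ ρ τ (∃⁰ A)   = cong ∃⁰ (renS-∘ ρ τ A)
renS-∘ ρ τ (∀¹ A)   =
  cong ∀¹ (trans (renS-∘ (liftρ ρ) (liftρ τ) A) (renS-cong (liftρ-∘ ρ τ) A))
renS-∘ ρ τ (∃¹ A)   =
  cong ∃¹ (trans (renS-∘ (liftρ ρ) (liftρ τ) A) (renS-cong (liftρ-∘ ρ τ) A))
renS-∘ ρ τ (∀² A)   = cong ∀² (renS-∘ ρ τ A)
renS-∘ ρ τ (∃² A)   = cong ∃² (renS-∘ ρ τ A)

renS-id : renS id ≗ id
renS-id (s ≐ t)  = refl
renS-id (t ∈¹ i) = refl
renS-id (i ∈² c) = refl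
renS-id (i ≺ j)  = refl
renS-id ⊥̇        = refl
renS-id (A ∧̇ B)  = cong₂ _∧̇_ (renS-id A) (renS-id B)
renS-id (A ∨̇ B)  = cong₂ _∨̇_ (renS-id A) (renS-id B)
renS-id (A ⇒ B)  = cong₂ _⇒_ (renS-id A) (renS-id B)
renS-id (∀⁰ A)   = cong ∀⁰ (renS-id A)
renS-id (∃⁰ A)   = cong ∃⁰ (renS-id A)
renS-id (∀¹ A)   = cong ∀¹ (trans (renS-cong liftρ-id A) (renS-id A))
renS-id (∃¹ A)   = cong ∃¹ (trans (renS-cong liftρ-id A) (renS-id A))
renS-id (∀² A)   = cong ∀² (renS-id A)
renS-id (∃² A)   = cong ∃² (renS-id A)

renS-substN : ∀ ρ σ A → renS ρ (substN σ A) ≡ substN σ (renS ρ A)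
renS-substN ρ σ (s ≐ t)  = refl
renS-substN ρ σ (t ∈¹ i) = refl
renS-substN ρ σ (i ∈² c) = refl
renS-substN ρ σ (i ≺ j)  = refl
renS-substN ρ σ ⊥̇        = refl
renS-substN ρ σ (A ∧̇ B)  = cong₂ _∧̇_ (renS-substN ρ σ A) (renS-substN ρ σ B)
renS-substN ρ σ (A ∨̇ B)  = cong₂ _∨̇_ (renS-substN ρ σ A) (renS-substN ρ σ B)
renS-substN ρ σ (A ⇒ B)  = cong₂ _⇒_ (renS-substN ρ σ A) (renS-substN ρ σ B)
renS-substN ρ σ (∀⁰ A)   = cong ∀⁰ (renS-substN ρ (liftσ σ) A)
renS-substN ρ σ (∃⁰ A)   = cong ∃⁰ (renS-substN ρ (liftσ σ) A)
renS-substN ρ σ (∀¹ A)   = cong ∀¹ (renS-substN (liftρ ρ) σ A)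
renS-substN ρ σ (∃¹ A)   = cong ∃¹ (renS-substN (liftρ ρ) σ A)
renS-substN ρ σ (∀² A)   = cong ∀² (renS-substN ρ σ A)
renS-substN ρ σ (∃² A)   = cong ∃² (renS-substN ρ σ A)

renS-embAF : ∀ ρ A → renS ρ (embAF A) ≡ embAF A
renS-embAF ρ (a-eq s t)  = refl
renS-embAF ρ a-bot       = refl
renS-embAF ρ (a-and A B) = cong₂ _∧̇_ (renS-embAF ρ A) (renS-embAF ρ B)
renS-embAF ρ (a-or A B)  = cong₂ _∨̇_ (renS-embAF ρ A) (renS-embAF ρ B)
renS-embAF ρ (a-imp A B) = cong₂ _⇒_ (renS-embAF ρ A) (renS-embAF ρ B)
renS-embAF ρ (a-all A)   = cong ∀⁰ (renS-embAF ρ A)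
renS-embAF ρ (a-ex A)    = cong ∃⁰ (renS-embAF ρ A)

-- A composite of renamings and substitutions is a single substitution after a single
-- renaming, so two composites act alike once their composed maps agree pointwise.
-- The maps are usually concrete, and the pointwise agreement then holds by refl.

data Op : Set where
  ren : (ℕ → ℕ) → Op
  sub : (ℕ → Tm) → Op

applyOps : List Op → Fm → Fm
applyOps []           A = A
applyOps (ren ρ ∷ os) A = renS ρ (applyOps os A)
applyOps (sub σ ∷ os) A = substN σ (applyOps os A)

renamingOf : List Op → ℕ → ℕ
renamingOf []           = id
renamingOf (ren ρ ∷ os) = ρ ∘ renamingOf os
renamingOf (sub _ ∷ os) = renamingOf os

substitutionOf : List Op → ℕ → Tm
substitutionOf []           = v
substitutionOf (ren _ ∷ os) = substitutionOf os
substitutionOf (sub σ ∷ os) = substTm σ ∘ substitutionOf os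

applyOps-normal : ∀ os A →
  applyOps os A ≡ substN (substitutionOf os) (renS (renamingOf os) A)
applyOps-normal []           A = sym (trans (substN-id _) (renS-id A))
applyOps-normal (ren ρ ∷ os) A = trans (cong (renS ρ) (applyOps-normal os A))
  (trans (renS-substN ρ (substitutionOf os) _)
         (cong (substN (substitutionOf os)) (renS-∘ ρ (renamingOf os) A)))
applyOps-normal (sub σ ∷ os) A =
  trans (cong (substN σ) (applyOps-normal os A)) (substN-∘ σ (substitutionOf os) _)

applyOps-≗ : ∀ os os′ A → renamingOf os ≗ renamingOf os′ →
  substitutionOf os ≗ substitutionOf os′ → applyOps os A ≡ applyOps os′ A
applyOps-≗ os os′ A eρ eσ = trans (applyOps-normal os A) (trans
  (trans (cong (substN (substitutionOf os)) (renS-cong eρ A)) (substN-cong eσ _))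
  (sym (applyOps-normal os′ A)))

liftAbs-[v₀] : ∀ A → liftAbs A [ v 0 ] ≡ A
liftAbs-[v₀] A = applyOps-≗ (sub (inst (v 0)) ∷ sub (liftσ (v ∘ suc)) ∷ []) [] A
  (λ _ → refl) (λ { zero → refl ; (suc k) → refl })

instV₀-liftρ-suc : ∀ A → renS (instV 0) (renS (liftρ suc) A) ≡ A
instV₀-liftρ-suc A = applyOps-≗ (ren (instV 0) ∷ ren (liftρ suc) ∷ []) [] A
  (λ { zero → refl ; (suc k) → refl }) (λ _ → refl)

cast : ∀ {Γ A B} → A ≡ B → Γ ⊢ A → Γ ⊢ B
cast = subst (_ ⊢_)

castOps : ∀ {Γ} os os′ A → renamingOf os ≗ renamingOf os′ →
  substitutionOf os ≗ substitutionOf os′ → Γ ⊢ applyOps os A → Γ ⊢ applyOps os′ A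
castOps os os′ A eρ eσ = cast (applyOps-≗ os os′ A eρ eσ)

weaken : ∀ {Γ Δ A} → Γ ⊆ Δ → Γ ⊢ A → Δ ⊢ A
weaken s (hyp m)        = hyp (s m)
weaken s (axm a)        = axm a
weaken s (⊥E d)         = ⊥E (weaken s d)
weaken s (∧I d e)       = ∧I (weaken s d) (weaken s e)
weaken s (∧E₁ d)        = ∧E₁ (weaken s d)
weaken s (∧E₂ d)        = ∧E₂ (weaken s d)
weaken s (∨I₁ d)        = ∨I₁ (weaken s d)
weaken s (∨I₂ d)        = ∨I₂ (weaken s d)
weaken s (∨E d e f)     = ∨E (weaken s d) (weaken (∷⁺ʳ _ s) e) (weaken (∷⁺ʳ _ s) f)
weaken s (⇒I d)         = ⇒I (weaken (∷⁺ʳ _ s) d)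
weaken s (⇒E d e)       = ⇒E (weaken s d) (weaken s e)
weaken s (∀⁰I d)        = ∀⁰I (weaken (map⁺ shiftN s) d)
weaken s (∀⁰E d t)      = ∀⁰E (weaken s d) t
weaken s (∃⁰I t d)      = ∃⁰I t (weaken s d)
weaken s (∃⁰E d e)      = ∃⁰E (weaken s d) (weaken (∷⁺ʳ _ (map⁺ shiftN s)) e)
weaken s (∀¹I d)        = ∀¹I (weaken (map⁺ shiftS s) d)
weaken s (∀¹E d j)      = ∀¹E (weaken s d) j
weaken s (∃¹I j d)      = ∃¹I j (weaken s d)
weaken s (∃¹E d e)      = ∃¹E (weaken s d) (weaken (∷⁺ʳ _ (map⁺ shiftS s)) e)
weaken s (∀²I d)        = ∀²I (weaken (map⁺ shiftC s) d)
weaken s (∀²E d j)      = ∀²E (weaken s d) j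
weaken s (∃²I j d)      = ∃²I j (weaken s d)
weaken s (∃²E d e)      = ∃²E (weaken s d) (weaken (∷⁺ʳ _ (map⁺ shiftC s)) e)
weaken s (≐refl t)      = ≐refl t
weaken s (≐subst A d e) = ≐subst A (weaken s d) (weaken s e)

mp : ∀ {Γ A B} → [] ⊢ A ⇒ B → Γ ⊢ A → Γ ⊢ B
mp d = ⇒E (weaken (λ ()) d)

mp₂ : ∀ {Γ A B C} → [] ⊢ A ⇒ B ⇒ C → Γ ⊢ A → Γ ⊢ B → Γ ⊢ C
mp₂ d e = ⇒E (mp d e)

h₀ : ∀ {Γ A} → (A ∷ Γ) ⊢ A
h₀ = hyp (here refl)

h₁ : ∀ {Γ A B} → (B ∷ A ∷ Γ) ⊢ A
h₁ = hyp (there (here refl))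

h₂ : ∀ {Γ A B C} → (C ∷ B ∷ A ∷ Γ) ⊢ A
h₂ = hyp (there (there (here refl)))

h₃ : ∀ {Γ A B C D} → (D ∷ C ∷ B ∷ A ∷ Γ) ⊢ A
h₃ = hyp (there (there (there (here refl))))

∀⁰E₀ : ∀ {Γ} A → Γ ⊢ shiftN (∀⁰ A) → Γ ⊢ A
∀⁰E₀ A d = cast (liftAbs-[v₀] A) (∀⁰E d (v 0))

∃⁰I₀ : ∀ {Γ} A → Γ ⊢ A → Γ ⊢ shiftN (∃⁰ A)
∃⁰I₀ A d = ∃⁰I (v 0) (cast (sym (liftAbs-[v₀] A)) d)

∃¹I₀ : ∀ {Γ} A → Γ ⊢ A → Γ ⊢ shiftS (∃¹ A)
∃¹I₀ A d = ∃¹I 0 (cast (sym (instV₀-liftρ-suc A)) d)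

∀⁰-map : ∀ {A B} → [] ⊢ A ⇒ B → [] ⊢ ∀⁰ A ⇒ ∀⁰ B
∀⁰-map {A} d = ⇒I (∀⁰I (mp d (∀⁰E₀ A h₀)))

∃¹-map : ∀ {Γ A B} → [] ⊢ A ⇒ B → Γ ⊢ ∃¹ A → Γ ⊢ ∃¹ B
∃¹-map {B = B} d e = ∃¹E {B = ∃¹ B} e (∃¹I₀ B (mp d h₀))

∃¹-∧-const : ∀ A C → [] ⊢ C ⇒ ∃¹ A ⇒ ∃¹ (A ∧̇ shiftS C)
∃¹-∧-const A C = ⇒I (⇒I (∃¹E {B = ∃¹ (A ∧̇ shiftS C)} h₀ (∃¹I₀ (A ∧̇ shiftS C) (∧I h₀ h₂))))

data Arithmetical : Fm → Set where
  ar-≐  : ∀ s t → Arithmetical (s ≐ t)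
  ar-∈¹ : ∀ t i → Arithmetical (t ∈¹ i)
  ar-⊥  : Arithmetical ⊥̇
  ar-∧  : ∀ {A B} → Arithmetical A → Arithmetical B → Arithmetical (A ∧̇ B)
  ar-∨  : ∀ {A B} → Arithmetical A → Arithmetical B → Arithmetical (A ∨̇ B)
  ar-⇒  : ∀ {A B} → Arithmetical A → Arithmetical B → Arithmetical (A ⇒ B)
  ar-∀⁰ : ∀ {A} → Arithmetical A → Arithmetical (∀⁰ A)
  ar-∃⁰ : ∀ {A} → Arithmetical A → Arithmetical (∃⁰ A)

embAF-arithmetical : ∀ A → Arithmetical (embAF A)
embAF-arithmetical (a-eq s t)  = ar-≐ s t
embAF-arithmetical a-bot       = ar-⊥
embAF-arithmetical (a-and A B) = ar-∧ (embAF-arithmetical A) (embAF-arithmetical B)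
embAF-arithmetical (a-or A B)  = ar-∨ (embAF-arithmetical A) (embAF-arithmetical B)
embAF-arithmetical (a-imp A B) = ar-⇒ (embAF-arithmetical A) (embAF-arithmetical B)
embAF-arithmetical (a-all A)   = ar-∀⁰ (embAF-arithmetical A)
embAF-arithmetical (a-ex A)    = ar-∃⁰ (embAF-arithmetical A)

pairIn-arithmetical : ∀ a b Z → Arithmetical (pairIn a b Z)
pairIn-arithmetical a b Z = ar-∃⁰ (ar-∧ (ar-≐ _ _) (ar-∈¹ _ _))

arithmetical-decidable : ∀ {Γ A} → Arithmetical A → Γ ⊢ A ∨̇ ¬̇ A
arithmetical-decidable (ar-≐ s t) = axm (dec-≐ s t)
arithmetical-decidable (ar-∈¹ t i) = axm (dec-∈¹ t i)
arithmetical-decidable ar-⊥ = ∨I₂ (⇒I h₀)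
arithmetical-decidable (ar-∧ a b) =
  ∨E (arithmetical-decidable a)
     (∨E (arithmetical-decidable b) (∨I₁ (∧I h₁ h₀)) (∨I₂ (⇒I (⇒E h₁ (∧E₂ h₀)))))
     (∨I₂ (⇒I (⇒E h₁ (∧E₁ h₀))))
arithmetical-decidable (ar-∨ a b) =
  ∨E (arithmetical-decidable a) (∨I₁ (∨I₁ h₀))
     (∨E (arithmetical-decidable b) (∨I₁ (∨I₂ h₀))
         (∨I₂ (⇒I (∨E h₀ (⇒E h₃ h₀) (⇒E h₂ h₀)))))
arithmetical-decidable (ar-⇒ a b) =
  ∨E (arithmetical-decidable b) (∨I₁ (⇒I h₁))
     (∨E (arithmetical-decidable a) (∨I₂ (⇒I (⇒E h₂ (⇒E h₀ h₁))))
         (∨I₁ (⇒I (⊥E (⇒E h₁ h₀)))))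
arithmetical-decidable {A = ∀⁰ A} (ar-∀⁰ a) =
  ∨E (⇒E (axm (omni A (¬̇ A))) (∀⁰I (arithmetical-decidable a)))
     (∨I₁ h₀)
     (∨I₂ (⇒I (∃⁰E {B = ⊥̇} h₁ (⇒E h₀ (∀⁰E₀ A h₁)))))
arithmetical-decidable {A = ∃⁰ A} (ar-∃⁰ a) =
  ∨E (⇒E (axm (omni (¬̇ A) A)) (∀⁰I (∨E (arithmetical-decidable a) (∨I₂ h₀) (∨I₁ h₀))))
     (∨I₂ (⇒I (∃⁰E {B = ⊥̇} h₀ (⇒E (∀⁰E₀ (¬̇ A) h₂) h₀))))
     (∨I₁ h₀)

comprehension : ∀ {Γ A} → Arithmetical A → Γ ⊢ ∃¹ (∀⁰ (v 0 ∈¹ 0 ⇔ shiftS A))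
comprehension {A = A} a = ⇒E (axm (comp² A)) (∀⁰I (arithmetical-decidable a))

_⊆ˢ_ : ℕ → ℕ → Fm
i ⊆ˢ j = ∀⁰ (v 0 ∈¹ i ⇒ v 0 ∈¹ j)

-- θ is an abstraction: its number variable 0 is the element.
_⊆ᶜ_ : ℕ → Fm → Fm
i ⊆ᶜ θ = ∀⁰ (v 0 ∈¹ i ⇒ θ)

Witness : SPF → Fm → Fm
Witness φ θ = ∃¹ (0 ⊆ᶜ shiftS θ ∧̇ embX φ)

HasWitness : SPF → Fm → Set
HasWitness φ θ = [] ⊢ plug θ φ ⇒ Witness φ θ

IsEmpty : Fm
IsEmpty = ∀⁰ (v 0 ∈¹ 0 ⇔ ⊥̇)

IsSingleton : Tm → Fm
IsSingleton t = ∀⁰ (v 0 ∈¹ 0 ⇔ shiftTm t ≐ v 0)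

IsUnion : Fm
IsUnion = ∀⁰ (v 0 ∈¹ 0 ⇔ (v 0 ∈¹ 1 ∨̇ v 0 ∈¹ 2))

∃-empty : ∀ {Γ} → Γ ⊢ ∃¹ IsEmpty
∃-empty = comprehension ar-⊥

∃-singleton : ∀ {Γ} t → Γ ⊢ ∃¹ (IsSingleton t)
∃-singleton t = comprehension (ar-≐ (shiftTm t) (v 0))

∃-union : ∀ {Γ} → Γ ⊢ ∃¹ IsUnion
∃-union = comprehension (ar-∨ (ar-∈¹ (v 0) 0) (ar-∈¹ (v 0) 1))

empty-⊆ᶜ : ∀ θ → [] ⊢ IsEmpty ⇒ 0 ⊆ᶜ θ
empty-⊆ᶜ θ = ⇒I (∀⁰I (⇒I (⊥E (⇒E (∧E₁ (∀⁰E h₁ (v 0))) h₀))))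

singleton-∋ : ∀ t → [] ⊢ IsSingleton t ⇒ t ∈¹ 0
singleton-∋ t = ⇒I (⇒E (∧E₂ (∀⁰E h₀ t)) (cast (cong (_≐ t) (sym shiftTm-[t])) (≐refl t)))
  where
  shiftTm-[t] : substTm (inst t) (shiftTm t) ≡ t
  shiftTm-[t] = trans (substTm-∘ (inst t) (v ∘ suc) t) (substTm-id t)

-- z ∈ {t} gives t ≐ z, which transports θ(t) to θ(z).
singleton-⊆ᶜ : ∀ θ t → [] ⊢ IsSingleton t ⇒ shiftS (θ [ t ]) ⇒ 0 ⊆ᶜ shiftS θ
singleton-⊆ᶜ θ t = ⇒I (⇒I (∀⁰I (⇒I (cast (liftAbs-[v₀] (shiftS θ))
  (≐subst (liftAbs (shiftS θ))
    (⇒E (∧E₁ (∀⁰E₀ (v 0 ∈¹ 0 ⇔ shiftTm t ≐ v 0) h₂)) h₀)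
    (cast θ[t]-shifted h₁))))))
  where
  θ[t]-shifted : shiftN (shiftS (θ [ t ])) ≡ liftAbs (shiftS θ) [ shiftTm t ]
  θ[t]-shifted = applyOps-≗
    (sub (v ∘ suc) ∷ ren suc ∷ sub (inst t) ∷ [])
    (sub (inst (shiftTm t)) ∷ sub (liftσ (v ∘ suc)) ∷ ren suc ∷ []) θ
    (λ _ → refl) (λ { zero → refl ; (suc k) → refl })

union-⊇ˡ : [] ⊢ IsUnion ⇒ 1 ⊆ˢ 0
union-⊇ˡ = ⇒I (∀⁰I (⇒I (⇒E (∧E₂ (∀⁰E₀ (v 0 ∈¹ 0 ⇔ (v 0 ∈¹ 1 ∨̇ v 0 ∈¹ 2)) h₁)) (∨I₁ h₀))))

union-⊇ʳ : [] ⊢ IsUnion ⇒ 2 ⊆ˢ 0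
union-⊇ʳ = ⇒I (∀⁰I (⇒I (⇒E (∧E₂ (∀⁰E₀ (v 0 ∈¹ 0 ⇔ (v 0 ∈¹ 1 ∨̇ v 0 ∈¹ 2)) h₁)) (∨I₂ h₀))))

union-⊆ᶜ : ∀ θ → [] ⊢ IsUnion ⇒ 1 ⊆ᶜ θ ⇒ 2 ⊆ᶜ θ ⇒ 0 ⊆ᶜ θ
union-⊆ᶜ θ = ⇒I (⇒I (⇒I (∀⁰I (⇒I
  (∨E (⇒E (∧E₁ (∀⁰E₀ (v 0 ∈¹ 0 ⇔ (v 0 ∈¹ 1 ∨̇ v 0 ∈¹ 2)) h₃)) h₀)
      (⇒E (∀⁰E₀ (v 0 ∈¹ 1 ⇒ θ) h₃) h₀)
      (⇒E (∀⁰E₀ (v 0 ∈¹ 2 ⇒ θ) h₂) h₀))))))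

embX-mono : ∀ φ σ ρ ρ′ →
  [] ⊢ ρ 0 ⊆ˢ ρ′ 0 ⇒ substN σ (renS ρ (embX φ)) ⇒ substN σ (renS ρ′ (embX φ))
embX-mono (s-eq s t) σ ρ ρ′ = ⇒I (⇒I h₀)
embX-mono (s-mem t) σ ρ ρ′ = ⇒I (⇒I (⇒E (∀⁰E h₁ (substTm σ t)) h₀))
embX-mono s-bot σ ρ ρ′ = ⇒I (⇒I h₀)
embX-mono (s-and A B) σ ρ ρ′ =
  ⇒I (⇒I (∧I (mp₂ (embX-mono A σ ρ ρ′) h₁ (∧E₁ h₀)) (mp₂ (embX-mono B σ ρ ρ′) h₁ (∧E₂ h₀))))
embX-mono (s-or A B) σ ρ ρ′ =
  ⇒I (⇒I (∨E h₀ (∨I₁ (mp₂ (embX-mono A σ ρ ρ′) h₂ h₀)) (∨I₂ (mp₂ (embX-mono B σ ρ ρ′) h₂ h₀))))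
embX-mono (s-imp A B) σ ρ ρ′ =
  ⇒I (⇒I (⇒I (mp₂ (embX-mono B σ ρ ρ′) h₂ (⇒E h₁ (cast antecedent-X-free h₀)))))
  where
  antecedent-X-free : substN σ (renS ρ′ (embAF A)) ≡ substN σ (renS ρ (embAF A))
  antecedent-X-free = cong (substN σ) (trans (renS-embAF ρ′ A) (sym (renS-embAF ρ A)))
embX-mono (s-all B) σ ρ ρ′ =
  ⇒I (⇒I (∀⁰I (mp₂ (embX-mono B (liftσ σ) ρ ρ′) h₁ (∀⁰E₀ _ h₀))))
embX-mono (s-ex B) σ ρ ρ′ =
  ⇒I (⇒I (∃⁰E {B = substN σ (renS ρ′ (embX (s-ex B)))} h₀
    (∃⁰I₀ _ (mp₂ (embX-mono B (liftσ σ) ρ ρ′) h₂ h₀))))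

embX-monoOps : ∀ {Γ} φ os os′ → substitutionOf os ≗ substitutionOf os′ →
  Γ ⊢ renamingOf os 0 ⊆ˢ renamingOf os′ 0 → Γ ⊢ applyOps os (embX φ) → Γ ⊢ applyOps os′ (embX φ)
embX-monoOps φ os os′ eσ inc d =
  cast (trans (substN-cong eσ _) (sym (applyOps-normal os′ (embX φ))))
    (mp₂ (embX-mono φ (substitutionOf os) (renamingOf os) (renamingOf os′)) inc
      (cast (applyOps-normal os (embX φ)) d))

shift₁ : ℕ → ℕ
shift₁ = liftρ suc

-- number variable 0 is n, set variable 1 is Z; set variable 0 is (Z)ₙ₊₁
IsNextSection : Fm
IsNextSection = ∀⁰ (v 0 ∈¹ 0 ⇔ pairIn (S (v 1)) (v 0) 1)

NextSectionsSatisfy : Fm → Fm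
NextSectionsSatisfy ψ = ∀⁰ (∃¹ (IsNextSection ∧̇ renS shift₁ ψ))

-- Dependent choice for a relation ignoring its first set argument, started at an arbitrary
-- set (the set variable 0), so the chosen sets are the sections (Z)ₙ₊₁.  To use the chain
-- property, (Z)ₙ and (Z)ₙ₊₁ are first named by comprehension; ren _ is the renaming
-- local to dcFormula.
countableChoice : ∀ ψ → [] ⊢ ∀⁰ (∃¹ ψ) ⇒ ∃¹ (NextSectionsSatisfy ψ)
countableChoice ψ =
  ⇒I (∃¹E {B = ∃¹ (NextSectionsSatisfy ψ)}
    (∀¹E (⇒E (axm (dc ψ₁)) (mp (∀⁰-map (⇒I (∀¹I h₀))) h₀)) 0)
    (∃¹I₀ (NextSectionsSatisfy ψ) (∀⁰I
      (∃¹E {B = ∃¹ (IsNextSection ∧̇ ψ₁)}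
        (comprehension (pairIn-arithmetical (v 1) (v 0) 0))
        (∃¹E {B = shiftS (∃¹ (IsNextSection ∧̇ ψ₁))}
          (comprehension (pairIn-arithmetical (S (v 1)) (v 0) 1))
          (∃¹I 0 (∧I h₀
            (castOps
              (ren (instV 0) ∷ ren (liftρ (instV 1)) ∷ sub (inst (v 0))
                ∷ ren (liftρ (liftρ suc)) ∷ ren (liftρ (liftρ suc)) ∷ sub (liftσ (v ∘ suc))
                ∷ ren (liftρ (liftρ (liftρ (instV 0)))) ∷ ren _ ∷ ren shift₁ ∷ [])
              (ren (instV 0) ∷ ren shift₁ ∷ ren shift₁ ∷ ren shift₁ ∷ []) ψ
              (λ { zero → refl ; (suc k) → refl }) (λ { zero → refl ; (suc k) → refl })
              (⇒E (⇒E (∀¹E (∀¹E (∀⁰E (∧E₂ h₂) (v 0)) 1) 0) h₁) h₀)))))))))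
  where
  ψ₁ : Fm
  ψ₁ = renS shift₁ ψ

-- number variable 0 is an element; set variable 1 is Z and set variable 0 is ⋃ₙ (Z)ₙ₊₁
IsUnionOfNextSections : Fm
IsUnionOfNextSections = ∀⁰ (v 0 ∈¹ 0 ⇔ ∃⁰ (pairIn (S (v 0)) (v 1) 1))

∃-unionOfNextSections : ∀ {Γ} → Γ ⊢ ∃¹ IsUnionOfNextSections
∃-unionOfNextSections = comprehension (ar-∃⁰ (pairIn-arithmetical (S (v 0)) (v 1) 0))

unionOfNextSections-⊆ᶜ : ∀ θ P →
  [] ⊢ IsUnionOfNextSections ⇒ shiftS (NextSectionsSatisfy (0 ⊆ᶜ shiftS (liftAbs θ) ∧̇ P))
     ⇒ renS shift₁ (0 ⊆ᶜ shiftS θ)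
unionOfNextSections-⊆ᶜ θ P = ⇒I (⇒I (∀⁰I (⇒I
  (∃⁰E {B = applyOps θ-at-union θ}
    (⇒E (∧E₁ (∀⁰E₀ (v 0 ∈¹ 0 ⇔ ∃⁰ (pairIn (S (v 0)) (v 1) 1)) h₂)) h₀)
    (∃¹E {B = applyOps (sub (v ∘ suc) ∷ θ-at-union) θ} (∀⁰E h₂ (v 0))
      (castOps
        (sub (inst (v 1)) ∷ sub (liftσ (inst (v 0))) ∷ sub (liftσ (liftσ (v ∘ suc)))
          ∷ sub (liftσ (liftσ (v ∘ suc))) ∷ ren shift₁ ∷ ren shift₁ ∷ ren suc
          ∷ sub (liftσ (v ∘ suc)) ∷ [])
        (ren suc ∷ sub (v ∘ suc) ∷ θ-at-union) θ
        (λ _ → refl) (λ { zero → refl ; (suc k) → refl })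
        (⇒E (∀⁰E (∧E₁ (∧E₂ h₀)) (v 1)) (⇒E (∧E₂ (∀⁰E (∧E₁ h₀) (v 1))) h₁))))))))
  where
  θ-at-union : List Op
  θ-at-union = ren shift₁ ∷ ren suc ∷ []

unionOfNextSections-embX : ∀ B Q →
  [] ⊢ IsUnionOfNextSections ⇒ shiftS (NextSectionsSatisfy (Q ∧̇ embX B))
     ⇒ ∀⁰ (renS shift₁ (embX B))
unionOfNextSections-embX B Q = ⇒I (⇒I (∀⁰I
  (∃¹E {B = renS shift₁ (embX B)} (∀⁰E h₀ (v 0))
    (embX-monoOps B
      (sub (inst (v 0)) ∷ sub (liftσ (v ∘ suc)) ∷ ren shift₁ ∷ ren shift₁ ∷ [])
      (ren suc ∷ ren shift₁ ∷ [])
      (λ { zero → refl ; (suc k) → refl })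
      (∀⁰I (⇒I (⇒E (∧E₂ (∀⁰E₀ (v 0 ∈¹ 1 ⇔ ∃⁰ (pairIn (S (v 0)) (v 1) 2)) h₃))
        (∃⁰I (v 1) (⇒E (∧E₁ (∀⁰E₀ (v 0 ∈¹ 0 ⇔ pairIn (S (v 1)) (v 0) 2) (∧E₁ h₁))) h₀)))))
      (∧E₂ (∧E₂ h₀))))))

witness-≐ : ∀ θ s t → HasWitness (s-eq s t) θ
witness-≐ θ s t = ⇒I (∃¹-map (⇒I (∧I (mp (empty-⊆ᶜ _) (∧E₁ h₀)) (∧E₂ h₀)))
  (mp₂ (∃¹-∧-const IsEmpty (s ≐ t)) h₀ ∃-empty))

witness-∈ : ∀ θ t → HasWitness (s-mem t) θ
witness-∈ θ t = ⇒I (∃¹-map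
  (⇒I (∧I (mp₂ (singleton-⊆ᶜ θ t) (∧E₁ h₀) (∧E₂ h₀)) (mp (singleton-∋ t) (∧E₁ h₀))))
  (mp₂ (∃¹-∧-const (IsSingleton t) (θ [ t ])) h₀ (∃-singleton t)))

witness-⊥ : ∀ θ → HasWitness s-bot θ
witness-⊥ θ = ⇒I (⊥E h₀)

witness-∪ : ∀ θ A B → [] ⊢ Witness A θ ⇒ Witness B θ ⇒ Witness (s-and A B) θ
witness-∪ θ A B = ⇒I (⇒I (∃¹E {B = Witness (s-and A B) θ} h₁
  (∃¹E {B = shiftS (Witness (s-and A B) θ)} h₁
  (∃¹E {B = shiftS (shiftS (Witness (s-and A B) θ))} ∃-union
  (∃¹I₀ (applyOps twice-shift₁ (0 ⊆ᶜ shiftS θ ∧̇ embX (s-and A B)))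
    (∧I
      (cast (cong (0 ⊆ᶜ_) (applyOps-≗ thrice-suc (ren shift₁ ∷ ren shift₁ ∷ ren suc ∷ []) θ
          (λ _ → refl) (λ _ → refl)))
        (⇒E (mp₂ (union-⊆ᶜ (applyOps thrice-suc θ)) h₀
              (cast (cong (1 ⊆ᶜ_) (applyOps-≗ (ren suc ∷ ren shift₁ ∷ ren suc ∷ []) thrice-suc θ
                (λ _ → refl) (λ _ → refl))) (∧E₁ h₁)))
            (∧E₁ h₂)))
      (∧I
        (embX-monoOps A (ren suc ∷ ren suc ∷ []) twice-shift₁
          (λ _ → refl) (mp union-⊇ʳ h₀) (∧E₂ h₂))
        (embX-monoOps B (ren suc ∷ ren shift₁ ∷ []) twice-shift₁
          (λ _ → refl) (mp union-⊇ˡ h₀) (∧E₂ h₁)))))))))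
  where
  twice-shift₁ : List Op
  twice-shift₁ = ren shift₁ ∷ ren shift₁ ∷ []
  thrice-suc : List Op
  thrice-suc = ren suc ∷ ren suc ∷ ren suc ∷ []

witness-∧ : ∀ θ A B → HasWitness A θ → HasWitness B θ → HasWitness (s-and A B) θ
witness-∧ θ A B wA wB = ⇒I (mp₂ (witness-∪ θ A B) (mp wA (∧E₁ h₀)) (mp wB (∧E₂ h₀)))

witness-∨ : ∀ θ A B → HasWitness A θ → HasWitness B θ → HasWitness (s-or A B) θ
witness-∨ θ A B wA wB = ⇒I (∨E h₀
  (∃¹-map (⇒I (∧I (∧E₁ h₀) (∨I₁ (∧E₂ h₀)))) (mp wA h₀))
  (∃¹-map (⇒I (∧I (∧E₁ h₀) (∨I₂ (∧E₂ h₀)))) (mp wB h₀)))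

witness-⇒ : ∀ θ A B → HasWitness B θ → HasWitness (s-imp A B) θ
witness-⇒ θ A B wB = ⇒I (∨E (arithmetical-decidable (embAF-arithmetical A))
  (∃¹-map (⇒I (∧I (∧E₁ h₀) (⇒I (∧E₂ h₁)))) (mp wB (⇒E h₁ h₀)))
  (∃¹-map
    (⇒I (∧I (mp (empty-⊆ᶜ _) (∧E₁ h₀))
            (⇒I (⊥E (⇒E (cast (cong ¬̇_ (renS-embAF suc A)) (∧E₂ h₁)) h₀)))))
    (mp₂ (∃¹-∧-const IsEmpty (¬̇ embAF A)) h₀ ∃-empty)))

witness-∃ : ∀ θ B → HasWitness B (liftAbs θ) → HasWitness (s-ex B) θ
witness-∃ θ B wB = ⇒I (∃⁰E {B = Witness (s-ex B) θ} h₀ (∃¹-map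
  (⇒I (∧I (cast (cong (0 ⊆ᶜ_) (renS-substN suc (liftσ (v ∘ suc)) θ)) (∧E₁ h₀))
          (∃⁰I₀ (embX B) (∧E₂ h₀))))
  (mp wB h₀)))

witness-∀ : ∀ θ B → HasWitness B (liftAbs θ) → HasWitness (s-all B) θ
witness-∀ θ B wB = ⇒I (∃¹E {B = Witness (s-all B) θ}
  (mp (countableChoice (0 ⊆ᶜ shiftS (liftAbs θ) ∧̇ embX B)) (mp (∀⁰-map wB) h₀))
  (∃¹E {B = shiftS (Witness (s-all B) θ)} ∃-unionOfNextSections
    (∃¹I₀ (renS shift₁ (0 ⊆ᶜ shiftS θ ∧̇ ∀⁰ (embX B)))
      (∧I (mp₂ (unionOfNextSections-⊆ᶜ θ (embX B)) h₀ h₁)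
          (mp₂ (unionOfNextSections-embX B (0 ⊆ᶜ shiftS (liftAbs θ))) h₀ h₁)))))

witness : ∀ φ θ → HasWitness φ θ
witness (s-eq s t) θ  = witness-≐ θ s t
witness (s-mem t) θ   = witness-∈ θ t
witness s-bot θ       = witness-⊥ θ
witness (s-and A B) θ = witness-∧ θ A B (witness A θ) (witness B θ)
witness (s-or A B) θ  = witness-∨ θ A B (witness A θ) (witness B θ)
witness (s-imp A B) θ = witness-⇒ θ A B (witness B θ)
witness (s-all B) θ   = witness-∀ θ B (witness B (liftAbs θ))
witness (s-ex B) θ    = witness-∃ θ B (witness B (liftAbs θ))

mainTheorem6 : (φ : SPF) (θ : Fm) →
    CM⊢ (∀⁰ (plug (liftAbs θ) φ ⇒ ∃¹ (∀⁰ (v 0 ∈¹ 0 ⇒ shiftS (liftAbs θ)) ∧̇ embX φ)))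
mainTheorem6 φ θ = ∀⁰I (witness φ (liftAbs θ))
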